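{- Fix a monitoring window $k\ge1$. If the number of monitored transactions in monitoring trees is bounded by a constant, then the number of nodes of monitoring trees is bounded by $\mathcal O(k)$.
   Context: A transaction-execution function $\mathsf{applyTx}(t,n)$, applied to a transaction $t$ and configuration $n$, returns $\mathrm{commit}(n_c)$, $\mathrm{fail}(n_f)$, or $\mathrm{pending}(n_c,n_f)$; a transaction is monitored if it activates a future monitor, in which case $\mathsf{applyTx}$ returns $\mathrm{pending}(n_c,n_f)$; otherwise it yields a single outcome. A monitoring tree is a finite rooted directed tree whose nodes are configurations; each internal node has one or two children, all edges out of a node are labelled by the same transaction, each level corresponding to one pending transaction. Trees are built from a single initial configuration by $\mathsf{step}((H,\tau),t)$, which applies $\mathsf{extend}(\tau,t)$ (to each leaf $l$ attach one child if $\mathsf{applyTx}(t,l)$ is $\mathrm{commit}$ or $\mathrm{fail}$, two children if $\mathrm{pending}$) and then, if the height exceeds $k$, replaces the tree by one of the (pruned) successor subtrees of its root; monitoring trees thus have height at most $k$, with branching only at levels of monitored transactions. -}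

module Defs where

open import Data.Nat using (ℕ; zero; suc; _+_; _≤_; _<_; _⊔_)
open import Data.Bool using (Bool; true; false)
open import Data.Product using (∃; _×_)
open import Relation.Binary.PropositionalEquality using (_≡_)
open import Relation.Nullary using (¬_)

data Outcome (N : Set) : Set where
  commit  : N → Outcome N
  fail    : N → Outcome N
  pending : N → N → Outcome N

IsPending : {N : Set} → Outcome N → Set
IsPending o = ∃ λ nc → ∃ λ nf → o ≡ pending nc nf

-- A rooted tree whose nodes are configurations.  All edges out of a node
-- carry the same transaction label; a node has zero, one or two children.
mutual
  data MTree (N T : Set) : Set where
    node : N → Kids N T → MTree N T

  data Kids (N T : Set) : Set where
    none : Kids N T
    one  : T → MTree N T → Kids N T
    two  : T → MTree N T → MTree N T → Kids N T

module _ {N T : Set} where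

  height : MTree N T → ℕ
  height (node _ none)        = 0
  height (node _ (one _ s))   = suc (height s)
  height (node _ (two _ s u)) = suc (height s ⊔ height u)

  size : MTree N T → ℕ
  size (node _ none)        = 1
  size (node _ (one _ s))   = suc (size s)
  size (node _ (two _ s u)) = suc (size s + size u)

  -- number of monitored transactions labelling levels of the tree
  -- (maximum over root-leaf paths; all levels carry a single transaction)
  monCount : (T → Bool) → MTree N T → ℕ
  monCount m (node _ none)        = 0
  monCount m (node _ (one t s))   = b (m t) + monCount m s
    where b : Bool → ℕ
          b true = 1
          b false = 0
  monCount m (node _ (two t s u)) = b (m t) + (monCount m s ⊔ monCount m u)
    where b : Bool → ℕ
          b true = 1
          b false = 0

  data _∈Child_ (s : MTree N T) : MTree N T → Set where
    here-one  : ∀ {n t} → s ∈Child node n (one t s)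
    here-twoˡ : ∀ {n t u} → s ∈Child node n (two t s u)
    here-twoʳ : ∀ {n t u} → s ∈Child node n (two t u s)

  module _ (applyTx : T → N → Outcome N) where

    attach : T → N → Kids N T
    attach t l with applyTx t l
    ... | commit nc     = one t (node nc none)
    ... | fail nf       = one t (node nf none)
    ... | pending nc nf = two t (node nc none) (node nf none)

    extend : MTree N T → T → MTree N T
    extend (node l none)        t = node l (attach t l)
    extend (node n (one t' s))   t = node n (one t' (extend s t))
    extend (node n (two t' s u)) t = node n (two t' (extend s t) (extend u t))

    -- step((H,τ),t) with monitoring window k (nondeterministic pruning choice)
    data Step (k : ℕ) (τ : MTree N T) (t : T) : MTree N T → Set where
      keep  : height (extend τ t) ≤ k → Step k τ t (extend τ t)
      prune : ∀ {τ'} → k < height (extend τ t) → τ' ∈Child extend τ t →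
              Step k τ t τ'

    data Reachable (k : ℕ) (n₀ : N) : MTree N T → Set where
      init : Reachable k n₀ (node n₀ none)
      next : ∀ {τ τ'} t → Reachable k n₀ τ → Step k τ t τ' →
             Reachable k n₀ τ'

MonitorSpec : {N T : Set} → (T → N → Outcome N) → (T → Bool) → Set
MonitorSpec {N} {T} applyTx monitored =
  (∀ t n → monitored t ≡ true  → IsPending (applyTx t n)) ×
  (∀ t n → monitored t ≡ false → ¬ IsPending (applyTx t n))

-- A monitoring tree only branches at levels of monitored transactions, so each
-- root-leaf path of it meets at most c branchings and the tree has at most 2^c
-- nodes per level. Its height never exceeds the window k, so it has at most
-- (k + 1) 2^c ≤ 2^(c+1) k nodes.
module Submission where

open import Defs
open import Data.Nat using (ℕ; suc; _+_; _*_; _^_; _⊔_; _≤_; _<_; z≤n; s≤s)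
open import Data.Nat.Properties
open import Data.Nat.Tactic.RingSolver using (solve-∀)
open import Data.Bool using (Bool; true; false)
open import Data.Product using (∃; _,_; proj₂)
open import Data.Empty using (⊥-elim)
open import Relation.Binary.PropositionalEquality using (_≡_; refl; cong)
open import Relation.Nullary using (¬_)

module _ {N T : Set} where

  data BranchesMonitored (m : T → Bool) : MTree N T → Set where
    leaf   : ∀ {n} → BranchesMonitored m (node n none)
    unary  : ∀ {n t s} → BranchesMonitored m s → BranchesMonitored m (node n (one t s))
    binary : ∀ {n t s u} → m t ≡ true → BranchesMonitored m s → BranchesMonitored m u →
             BranchesMonitored m (node n (two t s u))

  BranchesMonitored-child : ∀ {m s τ} → s ∈Child τ → BranchesMonitored m τ → BranchesMonitored m s
  BranchesMonitored-child here-one  (unary b)      = b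
  BranchesMonitored-child here-twoˡ (binary _ b _) = b
  BranchesMonitored-child here-twoʳ (binary _ _ b) = b

  height-child : ∀ {s τ : MTree N T} → s ∈Child τ → height s < height τ
  height-child here-one  = ≤-refl
  height-child here-twoˡ = s≤s (m≤m⊔n _ _)
  height-child here-twoʳ = s≤s (m≤n⊔m _ _)

  monCount-unary : ∀ m n t (s : MTree N T) → monCount m s ≤ monCount m (node n (one t s))
  monCount-unary m n t s with m t
  ... | true  = n≤1+n _
  ... | false = ≤-refl

  size≤suc-height*2^monCount : ∀ {m} τ → BranchesMonitored m τ →
                               size τ ≤ suc (height τ) * 2 ^ monCount m τ
  size≤suc-height*2^monCount (node _ none) leaf = ≤-refl
  size≤suc-height*2^monCount {m} (node n (one t s)) (unary b) = begin
    suc (size s)                      ≤⟨ +-mono-≤ (m^n>0 2 M) (size≤suc-height*2^monCount s b) ⟩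
    suc (suc (height s)) * 2 ^ M      ≤⟨ *-monoʳ-≤ (suc (suc (height s))) (^-monoʳ-≤ 2 (monCount-unary m n t s)) ⟩
    suc (suc (height s)) * 2 ^ monCount m (node n (one t s)) ∎
    where
      open ≤-Reasoning
      M = monCount m s
  size≤suc-height*2^monCount {m} (node _ (two t s u)) (binary mt bs bu) rewrite mt = begin
    suc (size s + size u)                 ≤⟨ s≤s (+-mono-≤ (bound s bs (m≤m⊔n _ _) (m≤m⊔n _ _))
                                                           (bound u bu (m≤n⊔m _ _) (m≤n⊔m _ _))) ⟩
    suc (suc H * 2 ^ M + suc H * 2 ^ M)   ≡⟨ cong suc (double-* (suc H) (2 ^ M)) ⟩
    suc (suc H * 2 ^ suc M)               ≤⟨ +-monoˡ-≤ _ (m^n>0 2 (suc M)) ⟩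
    suc (suc H) * 2 ^ suc M               ∎
    where
      open ≤-Reasoning
      H = height s ⊔ height u
      M = monCount m s ⊔ monCount m u
      double-* : ∀ a x → a * x + a * x ≡ a * (2 * x)
      double-* = solve-∀
      bound : ∀ v → BranchesMonitored m v → height v ≤ H → monCount m v ≤ M →
              size v ≤ suc H * 2 ^ M
      bound v b h≤H c≤M = ≤-trans (size≤suc-height*2^monCount v b)
                                  (*-mono-≤ (s≤s h≤H) (^-monoʳ-≤ 2 c≤M))

module _ {N T : Set} (applyTx : T → N → Outcome N) where

  height-attach : ∀ l t → height (node l (attach applyTx t l)) ≤ 1
  height-attach l t with applyTx t l
  ... | commit _    = ≤-refl
  ... | fail _      = ≤-refl
  ... | pending _ _ = ≤-refl

  height-extend : ∀ τ t → height (extend applyTx τ t) ≤ suc (height τ)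
  height-extend (node l none)        t = height-attach l t
  height-extend (node _ (one _ s))   t = s≤s (height-extend s t)
  height-extend (node _ (two _ s u)) t = s≤s (⊔-mono-≤ (height-extend s t) (height-extend u t))

  Reachable⇒height≤k : ∀ {k n₀ τ} → Reachable applyTx k n₀ τ → height τ ≤ k
  Reachable⇒height≤k init                          = z≤n
  Reachable⇒height≤k (next t r (keep h≤k))         = h≤k
  Reachable⇒height≤k (next {τ} t r (prune _ child)) =
    ≤-pred (≤-trans (height-child child) (≤-trans (height-extend τ t) (s≤s (Reachable⇒height≤k r))))

  module _ (monitored : T → Bool)
           (unmonitored⇒¬pending : ∀ t n → monitored t ≡ false → ¬ IsPending (applyTx t n)) where

    pending⇒monitored : ∀ {t l nc nf} → applyTx t l ≡ pending nc nf → monitored t ≡ true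
    pending⇒monitored {t} {l} {nc} {nf} eq with monitored t in mt
    ... | true  = refl
    ... | false = ⊥-elim (unmonitored⇒¬pending t l mt (nc , nf , eq))

    BranchesMonitored-attach : ∀ l t → BranchesMonitored monitored (node l (attach applyTx t l))
    BranchesMonitored-attach l t with applyTx t l in eq
    ... | commit _    = unary leaf
    ... | fail _      = unary leaf
    ... | pending _ _ = binary (pending⇒monitored eq) leaf leaf

    BranchesMonitored-extend : ∀ {τ} t → BranchesMonitored monitored τ →
                               BranchesMonitored monitored (extend applyTx τ t)
    BranchesMonitored-extend {node l _} t leaf = BranchesMonitored-attach l t
    BranchesMonitored-extend t (unary b)       = unary (BranchesMonitored-extend t b)
    BranchesMonitored-extend t (binary mt b c) =
      binary mt (BranchesMonitored-extend t b) (BranchesMonitored-extend t c)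

    Reachable⇒BranchesMonitored : ∀ {k n₀ τ} → Reachable applyTx k n₀ τ → BranchesMonitored monitored τ
    Reachable⇒BranchesMonitored init                    = leaf
    Reachable⇒BranchesMonitored (next t r (keep _))      = BranchesMonitored-extend t (Reachable⇒BranchesMonitored r)
    Reachable⇒BranchesMonitored (next t r (prune _ child)) =
      BranchesMonitored-child child (BranchesMonitored-extend t (Reachable⇒BranchesMonitored r))

suc[k]*x≤2*x*k : ∀ {k} x → 1 ≤ k → suc k * x ≤ 2 * x * k
suc[k]*x≤2*x*k {k} x 1≤k = begin
  suc k * x      ≤⟨ *-monoˡ-≤ x (+-monoˡ-≤ k 1≤k) ⟩
  (k + k) * x    ≡⟨ double-comm k x ⟩
  2 * x * k      ∎
  where
    open ≤-Reasoning
    double-comm : ∀ k x → (k + k) * x ≡ 2 * x * k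
    double-comm = solve-∀

corollary2 : (c : ℕ) → ∃ λ (C : ℕ) →
    {N T : Set} (applyTx : T → N → Outcome N) (monitored : T → Bool) →
    MonitorSpec applyTx monitored →
    (k : ℕ) → 1 ≤ k → (n₀ : N) (τ : MTree N T) →
    Reachable applyTx k n₀ τ → monCount monitored τ ≤ c →
    size τ ≤ C * k
corollary2 c = 2 ^ suc c , λ applyTx monitored spec k 1≤k n₀ τ r monCount≤c → begin
  size τ                                   ≤⟨ size≤suc-height*2^monCount τ
                                                (Reachable⇒BranchesMonitored applyTx monitored (proj₂ spec) r) ⟩
  suc (height τ) * 2 ^ monCount monitored τ ≤⟨ *-mono-≤ (s≤s (Reachable⇒height≤k applyTx r)) (^-monoʳ-≤ 2 monCount≤c) ⟩
  suc k * 2 ^ c                            ≤⟨ suc[k]*x≤2*x*k (2 ^ c) 1≤k ⟩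
  2 ^ suc c * k                            ∎
  where open ≤-Reasoning
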